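{- Let $\Phi$ be a CNF formula on variables $x_1,\dots,x_n$ in which every clause contains between $k$ and $6k$ distinct variables and every variable appears in at most $d$ clauses, and let $x$ be a variable such that $\Phi$ has satisfying assignments with $x=T$ and with $x=F$. Run the coupling procedure described in the context on $\Phi$ and $x$, and let $V_I$ be the final set. Let $G$ be the graph on vertex set $V_I$ in which two variables are adjacent iff they appear together in some clause of the original formula $\Phi$. Then any maximal $3$-tree in $G$ contains at least $\frac{|V_I|}{2(6dk)^2}$ vertices.
   Context: A $3$-tree in $G$ is a subset $T\subseteq V_I$ such that any two distinct vertices of $T$ are at distance at least $3$ in $G$, and the graph on $T$ obtained by joining vertices at distance exactly $3$ in $G$ is connected; maximal means maximal under inclusion. Coupling procedure: the variables of $\Phi$ are labeled marked/unmarked by a fixed labeling. The procedure maintains two partial assignments $\mathcal{A}_1,\mathcal{A}_2$ (always setting the same set of variables), a partition $V_I\cup V_O$ of the variables, and a set of remaining clauses (initially all clauses). For $i=1,2$, $\mathcal{D}_i$ denotes the uniform distribution on satisfying assignments of $\Phi$ consistent with the current $\mathcal{A}_i$. Initially $\mathcal{A}_1(x)=T$, $\mathcal{A}_2(x)=F$, $V_I=\{x\}$, $V_O$ = all other variables. While there is a remaining clause $c$ with a variable in $V_I$ and a variable in $V_O$ (chosen by a fixed deterministic rule): its unset marked variables are set one at a time; to set $y$, let $p_i=\Pr_{\mathcal{D}_i}[y=T]$ and choose $(\mathcal{A}_1(y),\mathcal{A}_2(y))$ to be $(T,T)$ with probability $\min(p_1,p_2)$, $(F,F)$ with probability $\min(1-p_1,1-p_2)$,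 and otherwise $(T,F)$ if $p_1>p_2$ or $(F,T)$ if $p_1\le p_2$. Then: Case 1, if $c$ is satisfied by the variables already set in $\mathcal{A}_1$ and also in $\mathcal{A}_2$, let $S$ be the variables of $c$ with different values in $\mathcal{A}_1$ and $\mathcal{A}_2$, set $V_I\leftarrow V_I\cup S$, $V_O\leftarrow V_O\setminus S$, and delete $c$; Case 2, otherwise, let $S$ be all variables of $c$ and set $V_I\leftarrow V_I\cup S$, $V_O\leftarrow V_O\setminus S$. The procedure ends when no such clause exists. -}

module Defs where

open import Data.Nat using (ℕ; zero; suc; _+_; _*_; _∸_; _≤_; _<ᵇ_; _⊓_)
open import Data.Bool using (Bool; true; false; not; _∧_; _xor_; if_then_else_)
open import Data.Fin using (Fin; _≟_)
open import Data.Fin.Subset using (Subset; _∈_; _∉_; _∪_; _∩_; ∁; ⁅_⁆)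
open import Data.Maybe using (Maybe; just; nothing)
open import Data.Product using (_×_; _,_; proj₁; Σ; ∃)
open import Data.List using (List; []; _∷_; map; _++_; length; filter; filterᵇ; allFin)
open import Data.List.Relation.Unary.Any using (Any)
open import Data.List.Membership.Propositional using () renaming (_∈_ to _∈ₗ_)
open import Data.Bool.ListAction using (any; all)
open import Data.Vec using (Vec; lookup; tabulate) renaming ([] to []ᵥ; _∷_ to _∷ᵥ_)
open import Relation.Nullary using (¬_; does)
open import Relation.Binary.PropositionalEquality using (_≡_; _≢_)
open import Relation.Binary.Construct.Closure.ReflexiveTransitive using (Star)

-- A literal: a variable together with its polarity (true = positive).
Literal : ℕ → Set
Literal n = Fin n × Bool

Clause : ℕ → Set
Clause n = List (Literal n)

Formula : ℕ → ℕ → Set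
Formula n m = Fin m → Clause n

vars : ∀ {n} → Clause n → List (Fin n)
vars = map proj₁

memᵇ : ∀ {n} → Fin n → List (Fin n) → Bool
memᵇ y ys = any (λ z → does (y ≟ z)) ys

Assignment : ℕ → Set
Assignment n = Vec Bool n

_≡ᵇ_ : Bool → Bool → Bool
b ≡ᵇ c = not (b xor c)

litVal : ∀ {n} → Assignment n → Literal n → Bool
litVal σ (v , p) = lookup σ v ≡ᵇ p

satᵇ : ∀ {n m} → Formula n m → Assignment n → Bool
satᵇ {m = m} Φ σ = all (λ j → any (litVal σ) (Φ j)) (allFin m)

occ : ∀ {n m} → Formula n m → Fin n → ℕ
occ {m = m} Φ y = length (filterᵇ (λ j → memᵇ y (vars (Φ j))) (allFin m))

allAssign : (n : ℕ) → List (Assignment n)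
allAssign zero = []ᵥ ∷ []
allAssign (suc n) = map (true ∷ᵥ_) (allAssign n) ++ map (false ∷ᵥ_) (allAssign n)

PartialAssignment : ℕ → Set
PartialAssignment n = Fin n → Maybe Bool

agreesᵇ : Maybe Bool → Bool → Bool
agreesᵇ nothing  b = true
agreesᵇ (just c) b = c ≡ᵇ b

consistentᵇ : ∀ {n} → PartialAssignment n → Assignment n → Bool
consistentᵇ {n} A σ = all (λ i → agreesᵇ (A i) (lookup σ i)) (allFin n)

-- |support of D|: number of satisfying assignments consistent with A
countSat : ∀ {n m} → Formula n m → PartialAssignment n → ℕ
countSat {n} Φ A = length (filterᵇ (λ σ → satᵇ Φ σ ∧ consistentᵇ A σ) (allAssign n))

-- number of those with y = T; so Pr_D[y = T] = countSatT / countSat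
countSatT : ∀ {n m} → Formula n m → PartialAssignment n → Fin n → ℕ
countSatT {n} Φ A y =
  length (filterᵇ (λ σ → satᵇ Φ σ ∧ consistentᵇ A σ ∧ lookup σ y) (allAssign n))

-- Coupling weights of the outcomes (b₁ , b₂) for setting y, scaled by the
-- common denominator N₁·N₂ (so weight / (N₁·N₂) is the probability):
--   (T,T): min(p₁,p₂), (F,F): min(1-p₁,1-p₂),
--   remaining mass on (T,F) if p₁ > p₂, on (F,T) if p₁ ≤ p₂.
couplingWeight : ∀ {n m} → Formula n m → PartialAssignment n → PartialAssignment n →
                 Fin n → Bool → Bool → ℕ
couplingWeight Φ A₁ A₂ y b₁ b₂ = w b₁ b₂
  where
  N₁ = countSat Φ A₁
  N₂ = countSat Φ A₂
  T₁ = countSatT Φ A₁ y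
  T₂ = countSatT Φ A₂ y
  wTT = (T₁ * N₂) ⊓ (T₂ * N₁)
  wFF = ((N₁ ∸ T₁) * N₂) ⊓ ((N₂ ∸ T₂) * N₁)
  rest = (N₁ * N₂ ∸ wTT) ∸ wFF
  p₁>p₂ = (T₂ * N₁) <ᵇ (T₁ * N₂)
  w : Bool → Bool → ℕ
  w true  true  = wTT
  w false false = wFF
  w true  false = if p₁>p₂ then rest else 0
  w false true  = if p₁>p₂ then 0 else rest

record State (n m : ℕ) : Set where
  constructor state
  field
    A₁ A₂ : PartialAssignment n
    VI    : Subset n          -- V_O is its complement
    rem   : Subset m

open State public

initState : ∀ {n m} → Fin n → State n m
initState x = state (λ z → if does (z ≟ x) then just true else nothing)
                    (λ z → if does (z ≟ x) then just false else nothing)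
                    ⁅ x ⁆
                    (tabulate (λ _ → true))

update : ∀ {n} → PartialAssignment n → Fin n → Bool → PartialAssignment n
update A y b z = if does (z ≟ y) then just b else A z

Eligible : ∀ {n m} → Formula n m → State n m → Fin m → Set
Eligible Φ s c = c ∈ rem s
               × Σ _ (λ y → y ∈ₗ vars (Φ c) × y ∈ VI s)
               × Σ _ (λ y → y ∈ₗ vars (Φ c) × y ∉ VI s)

data SetOne {n m} (Φ : Formula n m) (marked : Subset n) (c : Fin m) :
            State n m → State n m → Set where
  setVar : ∀ s y b₁ b₂ →
           y ∈ₗ vars (Φ c) → y ∈ marked → A₁ s y ≡ nothing →
           ¬ (couplingWeight Φ (A₁ s) (A₂ s) y b₁ b₂ ≡ 0) →
           SetOne Φ marked c s
             (state (update (A₁ s) y b₁) (update (A₂ s) y b₂) (VI s) (rem s))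

SatisfiedBy : ∀ {n} → PartialAssignment n → Clause n → Set
SatisfiedBy A cl = Any (λ l → A (proj₁ l) ≡ just (Data.Product.proj₂ l)) cl

differᵇ : Maybe Bool → Maybe Bool → Bool
differᵇ (just a) (just b) = not (a ≡ᵇ b)
differᵇ _        _        = false

varSet : ∀ {n} → Clause n → Subset n
varSet cl = tabulate (λ y → memᵇ y (vars cl))

diffSet : ∀ {n m} → State n m → Clause n → Subset n
diffSet s cl = tabulate (λ y → memᵇ y (vars cl) ∧ differᵇ (A₁ s y) (A₂ s y))

data Step {n m} (Φ : Formula n m) (marked : Subset n) : State n m → State n m → Set where
  case1 : ∀ s c s₁ → Eligible Φ s c →
          Star (SetOne Φ marked c) s s₁ →
          (∀ y → y ∈ₗ vars (Φ c) → y ∈ marked → ¬ (A₁ s₁ y ≡ nothing)) →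
          SatisfiedBy (A₁ s₁) (Φ c) → SatisfiedBy (A₂ s₁) (Φ c) →
          Step Φ marked s
            (state (A₁ s₁) (A₂ s₁) (VI s₁ ∪ diffSet s₁ (Φ c)) (rem s₁ ∩ ∁ ⁅ c ⁆))
  case2 : ∀ s c s₁ → Eligible Φ s c →
          Star (SetOne Φ marked c) s s₁ →
          (∀ y → y ∈ₗ vars (Φ c) → y ∈ marked → ¬ (A₁ s₁ y ≡ nothing)) →
          ¬ (SatisfiedBy (A₁ s₁) (Φ c) × SatisfiedBy (A₂ s₁) (Φ c)) →
          Step Φ marked s
            (state (A₁ s₁) (A₂ s₁) (VI s₁ ∪ varSet (Φ c)) (rem s₁))

Terminal : ∀ {n m} → Formula n m → State n m → Set
Terminal Φ s = ∀ c → ¬ Eligible Φ s c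

FinalState : ∀ {n m} → Formula n m → Subset n → Fin n → State n m → Set
FinalState Φ marked x s = Star (Step Φ marked) (initState x) s × Terminal Φ s

Adj : ∀ {n m} → Formula n m → Subset n → Fin n → Fin n → Set
Adj Φ V u v = u ∈ V × v ∈ V × u ≢ v
            × ∃ (λ j → u ∈ₗ vars (Φ j) × v ∈ₗ vars (Φ j))

data Walk {n m} (Φ : Formula n m) (V : Subset n) : Fin n → Fin n → ℕ → Set where
  here  : ∀ {u} → u ∈ V → Walk Φ V u u 0
  there : ∀ {u w v ℓ} → Adj Φ V u w → Walk Φ V w v ℓ → Walk Φ V u v (suc ℓ)

DistLe : ∀ {n m} → Formula n m → Subset n → Fin n → Fin n → ℕ → Set
DistLe Φ V u v ℓ = ∃ (λ j → j ≤ ℓ × Walk Φ V u v j)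

Dist3 : ∀ {n m} → Formula n m → Subset n → Fin n → Fin n → Set
Dist3 Φ V u v = Walk Φ V u v 3 × ¬ DistLe Φ V u v 2

Is3Tree : ∀ {n m} → Formula n m → Subset n → Subset n → Set
Is3Tree Φ V T =
    (∀ u → u ∈ T → u ∈ V)
  × (∀ u v → u ∈ T → v ∈ T → u ≢ v → ¬ DistLe Φ V u v 2)
  × (∀ u v → u ∈ T → v ∈ T →
       Star (λ a b → a ∈ T × b ∈ T × Dist3 Φ V a b) u v)

IsMaximal3Tree : ∀ {n m} → Formula n m → Subset n → Subset n → Set
IsMaximal3Tree Φ V T =
  Is3Tree Φ V T × (∀ T′ → (∀ u → u ∈ T → u ∈ T′) → Is3Tree Φ V T′ → ∀ u → u ∈ T′ → u ∈ T)

-- Every step of the coupling procedure adds to V_I variables of a clause that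
-- already meets V_I, so the graph G on V_I stays connected. In a connected
-- graph a maximal 3-tree T is 2-dominating: walking from a vertex of T to any
-- vertex v, the first vertex at distance more than 2 from T would be at
-- distance exactly 3 from T and could be added to T. Hence V_I is covered by
-- the radius-2 balls around T, each of size at most 1 + Δ + Δ² ≤ 2Δ², where
-- Δ = 6dk bounds the number of clause-neighbours of a variable.
module Submission where

open import Defs
open import Data.Nat using (ℕ; _≤_; _*_; _^_)
open import Data.Bool using (true; false)
open import Data.Fin using (Fin)
open import Data.Fin.Subset using (Subset; ∣_∣)
open import Data.Product using (_×_; ∃)
open import Data.List using (length)
open import Data.List.Relation.Unary.Unique.Propositional using (Unique)
open import Data.Vec using (lookup)
open import Relation.Binary.PropositionalEquality using (_≡_)

open import Data.Nat using (zero; suc; _+_; _<_; z≤n; s≤s)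
open import Data.Nat.Properties
  using (≤-trans; ≤-refl; m≤n⇒m≤1+n; +-mono-≤; +-monoˡ-≤; *-mono-≤; *-monoˡ-≤; *-monoʳ-≤;
         *-comm; *-assoc; *-identityʳ; +-identityʳ; module ≤-Reasoning)
open import Data.Bool using (Bool; T)
open import Data.Bool.Properties using (T-≡; T-∧)
open import Data.Fin using (zero; suc; _≟_)
open import Data.Fin.Subset using (_∈_; _⊆_; _∪_; ⁅_⁆; inside; outside)
open import Data.Fin.Subset.Properties
  using (x∈⁅x⁆; x∈⁅y⁆⇒x≡y; x∈p∪q⁻; p⊆p∪q; q⊆p∪q) renaming (_∈?_ to _∈ˢ?_)
open import Data.Fin.Properties using (any?)
open import Data.List using (List; []; _∷_; map; _++_; concatMap; filterᵇ; allFin)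
open import Data.List.Properties using (length-map; length-++)
open import Data.List.Relation.Unary.Any using (here; there)
import Data.List.Relation.Unary.Any as Any
open import Data.List.Membership.Propositional using (lose) renaming (_∈_ to _∈ₗ_)
open import Data.List.Membership.Propositional.Properties
  using (∈-allFin; ∈-filter⁺; ∈-concatMap⁺; ∈-++⁺ˡ; ∈-++⁺ʳ; ∈-map⁺)
import Data.Vec as Vec
open import Data.Vec.Properties using ([]=⇒lookup; lookup∘tabulate)
open import Data.Product using (_,_; proj₁; proj₂)
open import Data.Sum using (_⊎_; inj₁; inj₂)
open import Data.Empty using (⊥-elim)
open import Function using (_∘_; Equivalence)
open import Relation.Nullary using (¬_; yes; no)
open import Relation.Nullary.Decidable using (decidable-stable; _×-dec_; T?)
open import Relation.Binary.PropositionalEquality using (refl; sym; trans; cong; cong₂; subst; _≢_)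
open import Relation.Binary.Construct.Closure.ReflexiveTransitive using (Star; ε; _◅_; _◅◅_)
import Relation.Binary.Construct.Closure.ReflexiveTransitive as Star

private
  variable
    n m : ℕ

predecessors : List (Fin (suc n)) → List (Fin n)
predecessors []           = []
predecessors (zero  ∷ is) = predecessors is
predecessors (suc i ∷ is) = i ∷ predecessors is

length-predecessors : (is : List (Fin (suc n))) → length (predecessors is) ≤ length is
length-predecessors []           = z≤n
length-predecessors (zero  ∷ is) = m≤n⇒m≤1+n (length-predecessors is)
length-predecessors (suc i ∷ is) = s≤s (length-predecessors is)

length-predecessors-< : (is : List (Fin (suc n))) → zero ∈ₗ is →
                        length (predecessors is) < length is
length-predecessors-< (zero  ∷ is) _          = s≤s (length-predecessors is)
length-predecessors-< (suc i ∷ is) (there z∈) = s≤s (length-predecessors-< is z∈)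

∈-predecessors : ∀ {i : Fin n} (is : List (Fin (suc n))) → suc i ∈ₗ is → i ∈ₗ predecessors is
∈-predecessors (zero  ∷ is) (there p)   = ∈-predecessors is p
∈-predecessors (suc i ∷ is) (here refl) = here refl
∈-predecessors (suc i ∷ is) (there p)   = there (∈-predecessors is p)

⊆⇒∣p∣≤length : (p : Subset n) (is : List (Fin n)) → (∀ {i} → i ∈ p → i ∈ₗ is) → ∣ p ∣ ≤ length is
⊆⇒∣p∣≤length Vec.[]            is p⊆is = z≤n
⊆⇒∣p∣≤length (inside  Vec.∷ p) is p⊆is =
  ≤-trans (s≤s (⊆⇒∣p∣≤length p (predecessors is) (∈-predecessors is ∘ p⊆is ∘ Vec.there)))
          (length-predecessors-< is (p⊆is Vec.here))
⊆⇒∣p∣≤length (outside Vec.∷ p) is p⊆is =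
  ≤-trans (⊆⇒∣p∣≤length p (predecessors is) (∈-predecessors is ∘ p⊆is ∘ Vec.there))
          (length-predecessors is)

elements : Subset n → List (Fin n)
elements Vec.[]            = []
elements (inside  Vec.∷ p) = zero ∷ map suc (elements p)
elements (outside Vec.∷ p) = map suc (elements p)

length-elements : (p : Subset n) → length (elements p) ≡ ∣ p ∣
length-elements Vec.[]            = refl
length-elements (inside  Vec.∷ p) = cong suc (trans (length-map suc (elements p)) (length-elements p))
length-elements (outside Vec.∷ p) = trans (length-map suc (elements p)) (length-elements p)

∈-elements : (p : Subset n) {i : Fin n} → i ∈ p → i ∈ₗ elements p
∈-elements (inside  Vec.∷ p) Vec.here      = here refl
∈-elements (inside  Vec.∷ p) (Vec.there q) = there (∈-map⁺ suc (∈-elements p q))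
∈-elements (outside Vec.∷ p) (Vec.there q) = ∈-map⁺ suc (∈-elements p q)

length-concatMap≤ : ∀ {A B : Set} {f : A → List B} {c : ℕ} → (∀ a → length (f a) ≤ c) →
                    (as : List A) → length (concatMap f as) ≤ length as * c
length-concatMap≤ bound []               = z≤n
length-concatMap≤ {f = f} bound (a ∷ as) = begin
  length (f a ++ concatMap f as)         ≡⟨ length-++ (f a) ⟩
  length (f a) + length (concatMap f as) ≤⟨ +-mono-≤ (bound a) (length-concatMap≤ bound as) ⟩
  suc (length as) * _                    ∎
  where open ≤-Reasoning

cover⇒∣p∣≤∣q∣*c : (p q : Subset n) (f : Fin n → List (Fin n)) (c : ℕ) →
                  (∀ j → length (f j) ≤ c) →
                  (∀ {i} → i ∈ p → ∃ λ j → j ∈ q × i ∈ₗ f j) →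
                  ∣ p ∣ ≤ ∣ q ∣ * c
cover⇒∣p∣≤∣q∣*c p q f c bound cover = begin
  ∣ p ∣                                  ≤⟨ ⊆⇒∣p∣≤length p _ covered ⟩
  length (concatMap f (elements q))      ≤⟨ length-concatMap≤ bound (elements q) ⟩
  length (elements q) * c                ≡⟨ cong (_* c) (length-elements q) ⟩
  ∣ q ∣ * c                              ∎
  where
  open ≤-Reasoning
  covered : ∀ {i} → i ∈ p → i ∈ₗ concatMap f (elements q)
  covered i∈p with cover i∈p
  ... | j , j∈q , i∈fj = ∈-concatMap⁺ f (lose (∈-elements q j∈q) i∈fj)

1+c+c²≤2c² : ∀ c → 2 ≤ c → suc (c + c * c) ≤ 2 * c ^ 2
1+c+c²≤2c² c 2≤c = begin
  suc c + c * c  ≤⟨ +-monoˡ-≤ (c * c) 1+c≤c*c ⟩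
  c * c + c * c  ≡⟨ cong₂ _+_ c*c≡c² (trans c*c≡c² (sym (+-identityʳ (c ^ 2)))) ⟩
  2 * c ^ 2      ∎
  where
  open ≤-Reasoning
  1+c≤c*c : suc c ≤ c * c
  1+c≤c*c = begin
    1 + c      ≤⟨ +-monoˡ-≤ c (≤-trans (s≤s z≤n) 2≤c) ⟩
    c + c      ≡⟨ cong (c +_) (sym (+-identityʳ c)) ⟩
    2 * c      ≤⟨ *-monoˡ-≤ c 2≤c ⟩
    c * c      ∎
  c*c≡c² : c * c ≡ c ^ 2
  c*c≡c² = cong (c *_) (sym (*-identityʳ c))

memᵇ⇒∈ : ∀ {y : Fin n} ys → T (memᵇ y ys) → y ∈ₗ ys
memᵇ⇒∈ {y = y} (z ∷ zs) mem with y ≟ z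
... | yes refl = here refl
... | no _     = there (memᵇ⇒∈ zs mem)

∈⇒memᵇ : ∀ {y : Fin n} {ys} → y ∈ₗ ys → T (memᵇ y ys)
∈⇒memᵇ {y = y} {z ∷ zs} y∈ with y ≟ z | y∈
... | yes _   | _          = _
... | no y≢z  | here y≡z   = ⊥-elim (y≢z y≡z)
... | no _    | there y∈zs = ∈⇒memᵇ y∈zs

∈-tabulate⁻ : ∀ (f : Fin n → Bool) {i} → i ∈ Vec.tabulate f → T (f i)
∈-tabulate⁻ f {i} i∈ = Equivalence.from T-≡ (trans (sym (lookup∘tabulate f i)) ([]=⇒lookup i∈))

varSet⊆vars : (cl : Clause n) → ∀ {i} → i ∈ varSet cl → i ∈ₗ vars cl
varSet⊆vars cl = memᵇ⇒∈ (vars cl) ∘ ∈-tabulate⁻ _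

diffSet⊆vars : ∀ (s : State n m) (cl : Clause n) {i} → i ∈ diffSet s cl → i ∈ₗ vars cl
diffSet⊆vars s cl = memᵇ⇒∈ (vars cl) ∘ proj₁ ∘ Equivalence.to T-∧ ∘ ∈-tabulate⁻ _

module _ (Φ : Formula n m) where

  Adj-sym : ∀ {V u v} → Adj Φ V u v → Adj Φ V v u
  Adj-sym (u∈V , v∈V , u≢v , j , u∈j , v∈j) = v∈V , u∈V , u≢v ∘ sym , j , v∈j , u∈j

  walk-snoc : ∀ {V u v w ℓ} → Walk Φ V u v ℓ → Adj Φ V v w → Walk Φ V u w (suc ℓ)
  walk-snoc (here _)      vw = there vw (here (proj₁ (proj₂ vw)))
  walk-snoc (there uu′ p) vw = there uu′ (walk-snoc p vw)

  walk-reverse : ∀ {V u v ℓ} → Walk Φ V u v ℓ → Walk Φ V v u ℓ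
  walk-reverse (here u∈V)   = here u∈V
  walk-reverse (there uw p) = walk-snoc (walk-reverse p) (Adj-sym uw)

  walk-++ : ∀ {V u v w ℓ ℓ′} → Walk Φ V u v ℓ → Walk Φ V v w ℓ′ → Walk Φ V u w (ℓ + ℓ′)
  walk-++ (here _)      q = q
  walk-++ (there uu′ p) q = there uu′ (walk-++ p q)

  walk-mono : ∀ {V W u v ℓ} → V ⊆ W → Walk Φ V u v ℓ → Walk Φ W u v ℓ
  walk-mono V⊆W (here u∈V)                  = here (V⊆W u∈V)
  walk-mono V⊆W (there (u∈V , w∈V , adj) p) = there (V⊆W u∈V , V⊆W w∈V , adj) (walk-mono V⊆W p)

  DistLe-sym : ∀ {V u v ℓ} → DistLe Φ V u v ℓ → DistLe Φ V v u ℓ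
  DistLe-sym (j , j≤ℓ , p) = j , j≤ℓ , walk-reverse p

  Dist3-sym : ∀ {V u v} → Dist3 Φ V u v → Dist3 Φ V v u
  Dist3-sym (p , ¬close) = walk-reverse p , ¬close ∘ DistLe-sym

  ConnectedFrom : Subset n → Fin n → Set
  ConnectedFrom V x = x ∈ V × (∀ {v} → v ∈ V → ∃ λ ℓ → Walk Φ V x v ℓ)

  connected-⁅⁆ : ∀ x → ConnectedFrom ⁅ x ⁆ x
  connected-⁅⁆ x = x∈⁅x⁆ x , λ v∈ → trivial-walk (x∈⁅y⁆⇒x≡y x v∈)
    where
    trivial-walk : ∀ {v} → v ≡ x → ∃ λ ℓ → Walk Φ ⁅ x ⁆ x v ℓ
    trivial-walk refl = 0 , here (x∈⁅x⁆ x)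

  connected-∪-clause : ∀ {V x y} (S : Subset n) (c : Fin m) → ConnectedFrom V x →
                       y ∈ₗ vars (Φ c) → y ∈ V → (∀ {v} → v ∈ S → v ∈ₗ vars (Φ c)) →
                       ConnectedFrom (V ∪ S) x
  connected-∪-clause {V} {x} {y} S c (x∈V , reach) y∈c y∈V S⊆c = p⊆p∪q S x∈V , reach′
    where
    V⊆V∪S : V ⊆ V ∪ S
    V⊆V∪S = p⊆p∪q S
    reach′ : ∀ {v} → v ∈ V ∪ S → ∃ λ ℓ → Walk Φ (V ∪ S) x v ℓ
    reach′ {v} v∈ with x∈p∪q⁻ V S v∈ | v ≟ y
    ... | inj₁ v∈V | _       = proj₁ (reach v∈V) , walk-mono V⊆V∪S (proj₂ (reach v∈V))
    ... | inj₂ _   | yes refl = proj₁ (reach y∈V) , walk-mono V⊆V∪S (proj₂ (reach y∈V))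
    ... | inj₂ v∈S | no v≢y  =
      suc (proj₁ (reach y∈V)) ,
      walk-snoc (walk-mono V⊆V∪S (proj₂ (reach y∈V)))
                (V⊆V∪S y∈V , v∈ , v≢y ∘ sym , c , y∈c , S⊆c v∈S)

  -- Neighbour lists contain repetitions and the vertex itself; only their
  -- lengths matter for the counting.

  clausesOf : Fin n → List (Fin m)
  clausesOf u = filterᵇ (λ j → memᵇ u (vars (Φ j))) (allFin m)

  neighbours : Fin n → List (Fin n)
  neighbours u = concatMap (vars ∘ Φ) (clausesOf u)

  ball₂ : Fin n → List (Fin n)
  ball₂ t = t ∷ neighbours t ++ concatMap neighbours (neighbours t)

  Adj⇒∈neighbours : ∀ {V u v} → Adj Φ V u v → v ∈ₗ neighbours u
  Adj⇒∈neighbours {u = u} (_ , _ , _ , j , u∈j , v∈j) =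
    ∈-concatMap⁺ (vars ∘ Φ)
      (lose (∈-filter⁺ (T? ∘ λ j → memᵇ u (vars (Φ j))) (∈-allFin j) (∈⇒memᵇ u∈j)) v∈j)

  DistLe2⇒∈ball₂ : ∀ {V t v} → DistLe Φ V t v 2 → v ∈ₗ ball₂ t
  DistLe2⇒∈ball₂ (0 , _ , here _)             = here refl
  DistLe2⇒∈ball₂ (1 , _ , there tv (here _)) = there (∈-++⁺ˡ (Adj⇒∈neighbours tv))
  DistLe2⇒∈ball₂ {t = t} (2 , _ , there tw (there wv (here _))) =
    there (∈-++⁺ʳ (neighbours t)
            (∈-concatMap⁺ neighbours (lose (Adj⇒∈neighbours tw) (Adj⇒∈neighbours wv))))
  DistLe2⇒∈ball₂ (suc (suc (suc _)) , s≤s (s≤s ()) , _)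

  length-neighbours≤ : ∀ {w} → (∀ j → length (vars (Φ j)) ≤ w) → ∀ u →
                       length (neighbours u) ≤ occ Φ u * w
  length-neighbours≤ bound u = length-concatMap≤ bound (clausesOf u)

  length-ball₂≤ : ∀ {Δ} → (∀ u → length (neighbours u) ≤ Δ) → ∀ t →
                  length (ball₂ t) ≤ suc (Δ + Δ * Δ)
  length-ball₂≤ {Δ} bound t = s≤s (begin
    length (neighbours t ++ concatMap neighbours (neighbours t))
      ≡⟨ length-++ (neighbours t) ⟩
    length (neighbours t) + length (concatMap neighbours (neighbours t))
      ≤⟨ +-mono-≤ (bound t) (length-concatMap≤ bound (neighbours t)) ⟩
    Δ + length (neighbours t) * Δ
      ≤⟨ +-mono-≤ (≤-refl {Δ}) (*-monoˡ-≤ Δ (bound t)) ⟩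
    Δ + Δ * Δ ∎)
    where open ≤-Reasoning

module _ {Φ : Formula n m} {marked : Subset n} where

  SetOne-VI : ∀ {c s s′} → SetOne Φ marked c s s′ → VI s′ ≡ VI s
  SetOne-VI (setVar _ _ _ _ _ _ _ _) = refl

  SetOne*-VI : ∀ {c s s′} → Star (SetOne Φ marked c) s s′ → VI s′ ≡ VI s
  SetOne*-VI ε            = refl
  SetOne*-VI (set ◅ sets) = trans (SetOne*-VI sets) (SetOne-VI set)

  eligible-∪-connected : ∀ {x c s s₁} (S : Subset n) → Eligible Φ s c →
                         Star (SetOne Φ marked c) s s₁ →
                         (∀ {v} → v ∈ S → v ∈ₗ vars (Φ c)) →
                         ConnectedFrom Φ (VI s) x → ConnectedFrom Φ (VI s₁ ∪ S) x
  eligible-∪-connected {c = c} S (_ , (y , y∈c , y∈VI) , _) sets S⊆c conn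
    rewrite SetOne*-VI sets = connected-∪-clause Φ S c conn y∈c y∈VI S⊆c

  Step-connected : ∀ {x s s′} → Step Φ marked s s′ →
                   ConnectedFrom Φ (VI s) x → ConnectedFrom Φ (VI s′) x
  Step-connected (case1 s c s₁ elig sets _ _ _) =
    eligible-∪-connected (diffSet s₁ (Φ c)) elig sets (diffSet⊆vars s₁ (Φ c))
  Step-connected (case2 s c s₁ elig sets _ _) =
    eligible-∪-connected (varSet (Φ c)) elig sets (varSet⊆vars (Φ c))

  Step*-connected : ∀ {x s s′} → Star (Step Φ marked) s s′ →
                    ConnectedFrom Φ (VI s) x → ConnectedFrom Φ (VI s′) x
  Step*-connected ε              = λ conn → conn
  Step*-connected (step ◅ steps) = Step*-connected steps ∘ Step-connected step

module _ (Φ : Formula n m) (V : Subset n) where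

  Near : Subset n → Fin n → Set
  Near T v = ∃ λ t → t ∈ T × DistLe Φ V t v 2

  private
    Dist3In : Subset n → Fin n → Fin n → Set
    Dist3In T a b = a ∈ T × b ∈ T × Dist3 Φ V a b

  ⁅⁆-3Tree : ∀ {v} → v ∈ V → Is3Tree Φ V ⁅ v ⁆
  ⁅⁆-3Tree {v} v∈V = ⊆V , separated , linked
    where
    ⊆V : ∀ u → u ∈ ⁅ v ⁆ → u ∈ V
    ⊆V u u∈ with x∈⁅y⁆⇒x≡y v u∈
    ... | refl = v∈V
    separated : ∀ u w → u ∈ ⁅ v ⁆ → w ∈ ⁅ v ⁆ → u ≢ w → ¬ DistLe Φ V u w 2
    separated u w u∈ w∈ u≢w _ = u≢w (trans (x∈⁅y⁆⇒x≡y v u∈) (sym (x∈⁅y⁆⇒x≡y v w∈)))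
    linked : ∀ u w → u ∈ ⁅ v ⁆ → w ∈ ⁅ v ⁆ → Star (Dist3In ⁅ v ⁆) u w
    linked u w u∈ w∈ with x∈⁅y⁆⇒x≡y v u∈ | x∈⁅y⁆⇒x≡y v w∈
    ... | refl | refl = ε

  3Tree-∪-Dist3 : ∀ {T t b} → Is3Tree Φ V T → b ∈ V → ¬ Near T b →
                  t ∈ T → Dist3 Φ V t b → Is3Tree Φ V (T ∪ ⁅ b ⁆)
  3Tree-∪-Dist3 {T} {t} {b} (T⊆V , T-separated , T-linked) b∈V far t∈T tb = ⊆V , separated , linked
    where
    T′ = T ∪ ⁅ b ⁆
    T⊆T′ : T ⊆ T′
    T⊆T′ = p⊆p∪q ⁅ b ⁆
    b∈T′ : b ∈ T′
    b∈T′ = q⊆p∪q T ⁅ b ⁆ (x∈⁅x⁆ b)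
    ∈T′⁻ : ∀ {u} → u ∈ T′ → u ∈ T ⊎ u ≡ b
    ∈T′⁻ u∈ with x∈p∪q⁻ T ⁅ b ⁆ u∈
    ... | inj₁ u∈T = inj₁ u∈T
    ... | inj₂ u∈b = inj₂ (x∈⁅y⁆⇒x≡y b u∈b)
    lift : ∀ {u v} → Star (Dist3In T) u v → Star (Dist3In T′) u v
    lift = Star.map λ (u∈ , v∈ , uv) → T⊆T′ u∈ , T⊆T′ v∈ , uv
    ⊆V : ∀ u → u ∈ T′ → u ∈ V
    ⊆V u u∈ with ∈T′⁻ u∈
    ... | inj₁ u∈T = T⊆V u u∈T
    ... | inj₂ refl = b∈V
    separated : ∀ u v → u ∈ T′ → v ∈ T′ → u ≢ v → ¬ DistLe Φ V u v 2
    separated u v u∈ v∈ u≢v close with ∈T′⁻ u∈ | ∈T′⁻ v∈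
    ... | inj₁ u∈T | inj₁ v∈T = T-separated u v u∈T v∈T u≢v close
    ... | inj₁ u∈T | inj₂ refl = far (u , u∈T , close)
    ... | inj₂ refl | inj₁ v∈T = far (v , v∈T , DistLe-sym Φ close)
    ... | inj₂ refl | inj₂ refl = u≢v refl
    linked : ∀ u v → u ∈ T′ → v ∈ T′ → Star (Dist3In T′) u v
    linked u v u∈ v∈ with ∈T′⁻ u∈ | ∈T′⁻ v∈
    ... | inj₁ u∈T | inj₁ v∈T = lift (T-linked u v u∈T v∈T)
    ... | inj₁ u∈T | inj₂ refl = lift (T-linked u t u∈T t∈T) ◅◅ ((T⊆T′ t∈T , b∈T′ , tb) ◅ ε)
    ... | inj₂ refl | inj₁ v∈T = (b∈T′ , T⊆T′ t∈T , Dist3-sym Φ tb) ◅ lift (T-linked t v t∈T v∈T)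
    ... | inj₂ refl | inj₂ refl = ε

  module _ {T : Subset n} (maximal : IsMaximal3Tree Φ V T) where

    private
      tree = proj₁ maximal

      ∈-maximal : ∀ {T′ b} → T ⊆ T′ → Is3Tree Φ V T′ → b ∈ T′ → b ∈ T
      ∈-maximal {T′} T⊆T′ tree′ = proj₂ maximal T′ (λ _ → T⊆T′) tree′ _

      near-self : ∀ {v} → v ∈ V → v ∈ T → Near T v
      near-self v∈V v∈T = _ , v∈T , 0 , z≤n , here v∈V

    maximal-nonempty : ∀ {v} → v ∈ V → ¬ ¬ ∃ (_∈ T)
    maximal-nonempty {v} v∈V empty =
      empty (v , ∈-maximal (λ u∈T → ⊥-elim (empty (_ , u∈T))) (⁅⁆-3Tree v∈V) (x∈⁅x⁆ v))

    near-Adj : ∀ {a b} → Adj Φ V a b → Near T a → ¬ ¬ Near T b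
    near-Adj ab (t , t∈T , 0 , _ , ta) far = far (t , t∈T , 1 , s≤s z≤n , walk-snoc Φ ta ab)
    near-Adj ab (t , t∈T , 1 , _ , ta) far = far (t , t∈T , 2 , ≤-refl , walk-snoc Φ ta ab)
    near-Adj ab (t , t∈T , 2 , _ , ta) far =
      far (near-self b∈V (∈-maximal T⊆T∪b (3Tree-∪-Dist3 tree b∈V far t∈T tb) b∈T∪b))
      where
      b∈V = proj₁ (proj₂ ab)
      tb = walk-snoc Φ ta ab , λ close → far (t , t∈T , close)
      T⊆T∪b = p⊆p∪q ⁅ _ ⁆
      b∈T∪b = q⊆p∪q T ⁅ _ ⁆ (x∈⁅x⁆ _)
    near-Adj ab (t , t∈T , suc (suc (suc _)) , s≤s (s≤s ()) , _)

    near-Walk : ∀ {u v ℓ} → Walk Φ V u v ℓ → Near T u → ¬ ¬ Near T v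
    near-Walk (here _)     near-u far-v = far-v near-u
    near-Walk (there uw p) near-u far-v = near-Adj uw near-u λ near-w → near-Walk p near-w far-v

    maximal-dominating : ∀ {x v} → ConnectedFrom Φ V x → v ∈ V → ¬ ¬ Near T v
    maximal-dominating (_ , reach) v∈V far = maximal-nonempty v∈V λ (t , t∈T) →
      let t∈V = proj₁ tree t t∈T in
      near-Walk (walk-++ Φ (walk-reverse Φ (proj₂ (reach t∈V))) (proj₂ (reach v∈V)))
                (near-self t∈V t∈T) far

    maximal-ball₂-cover : ∀ {x v} → ConnectedFrom Φ V x → v ∈ V →
                          ∃ λ t → t ∈ T × v ∈ₗ ball₂ Φ t
    maximal-ball₂-cover {v = v} conn v∈V =
      decidable-stable (any? λ t → (t ∈ˢ? T) ×-dec Any.any? (v ≟_) (ball₂ Φ t))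
        λ uncovered → maximal-dominating conn v∈V
          λ (t , t∈T , close) → uncovered (t , t∈T , DistLe2⇒∈ball₂ Φ close)

-- The unique-variables hypothesis, the lower bound k on clause sizes and the
-- satisfiability of both values of x are not needed for this bound.
lemma3p12 : ∀ {n m} (Φ : Formula n m) (k d : ℕ) →
    1 ≤ k → 1 ≤ d →
    (∀ j → Unique (vars (Φ j))) →
    (∀ j → k ≤ length (Φ j) × length (Φ j) ≤ 6 * k) →
    (∀ y → occ Φ y ≤ d) →
    (x : Fin n) →
    ∃ (λ σ → satᵇ Φ σ ≡ true × lookup σ x ≡ true) →
    ∃ (λ σ → satᵇ Φ σ ≡ true × lookup σ x ≡ false) →
    (marked : Subset n) (s : State n m) → FinalState Φ marked x s →
    (T : Subset n) → IsMaximal3Tree Φ (VI s) T →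
    ∣ VI s ∣ ≤ 2 * (6 * d * k) ^ 2 * ∣ T ∣
lemma3p12 Φ k d 1≤k 1≤d _ size occ≤d x _ _ _ s (run , _) T maximal = begin
  ∣ VI s ∣                ≤⟨ cover⇒∣p∣≤∣q∣*c (VI s) T (ball₂ Φ) _ (length-ball₂≤ Φ degree≤Δ)
                               (maximal-ball₂-cover Φ (VI s) maximal connected) ⟩
  ∣ T ∣ * suc (Δ + Δ * Δ) ≤⟨ *-monoʳ-≤ ∣ T ∣ (1+c+c²≤2c² Δ 2≤Δ) ⟩
  ∣ T ∣ * (2 * Δ ^ 2)     ≡⟨ *-comm ∣ T ∣ _ ⟩
  2 * Δ ^ 2 * ∣ T ∣       ∎
  where
  open ≤-Reasoning
  Δ = 6 * d * k
  connected = Step*-connected run (connected-⁅⁆ Φ x)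
  2≤Δ : 2 ≤ Δ
  2≤Δ = ≤-trans (s≤s (s≤s z≤n)) (*-mono-≤ (*-mono-≤ (≤-refl {6}) 1≤d) 1≤k)
  clause≤6k : ∀ j → length (vars (Φ j)) ≤ 6 * k
  clause≤6k j = subst (_≤ 6 * k) (sym (length-map proj₁ (Φ j))) (proj₂ (size j))
  d*6k≡Δ : d * (6 * k) ≡ Δ
  d*6k≡Δ = trans (sym (*-assoc d 6 k)) (cong (_* k) (*-comm d 6))
  degree≤Δ : ∀ u → length (neighbours Φ u) ≤ Δ
  degree≤Δ u = ≤-trans (length-neighbours≤ Φ clause≤6k u)
                       (subst (occ Φ u * (6 * k) ≤_) d*6k≡Δ (*-monoˡ-≤ (6 * k) (occ≤d u)))
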